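{- Let $m$ be real and let $\alpha_0,\alpha_1,\ldots$ be real numbers. Then for every $n\ge0$ and every real $x$, \[ \prod_{i=0}^{n-1}(x+\alpha_i+im)=\sum_{k=0}^n L_{m,\bar{\alpha}}(n,k)\,(x;\bar{\alpha}|m)_k . \]
   Context: For real $m$ and reals $\bar{\alpha}=(\alpha_0,\alpha_1,\ldots)$ let $(x;\bar{\alpha}|m)_n=\prod_{j=0}^{n-1}(x-\alpha_j-jm)$ with $(x;\bar{\alpha}|m)_0=1$. The $\bar{\alpha}$-Whitney numbers of the first kind $w_{m,\bar{\alpha}}(n,k)$ and second kind $W_{m,\bar{\alpha}}(n,k)$ are defined by $(x;\bar{\alpha}|m)_n=\sum_{k=0}^n w_{m,\bar{\alpha}}(n,k)x^k$ and $x^n=\sum_{k=0}^n W_{m,\bar{\alpha}}(n,k)(x;\bar{\alpha}|m)_k$ (both zero for $k>n$ or $k<0$). The $\bar{\alpha}$-Whitney-Lah numbers are $L_{m,\bar{\alpha}}(n,k)=\sum_{j=k}^n(-1)^{n-j}w_{m,\bar{\alpha}}(n,j)W_{m,\bar{\alpha}}(j,k)$, with $L_{m,\bar{\alpha}}(0,0)=1$ and $L_{m,\bar{\alpha}}(n,k)=0$ for $n<k$ or $k<0$. -}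

module Defs where

open import Level using (Level)
open import Algebra.Bundles using (CommutativeRing)
open import Data.Nat using (ℕ; zero; suc; _∸_; _<_)
open import Data.Product using (_×_)
open import Relation.Nullary using (yes; no)
import Data.Nat as ℕ

module _ {c ℓ : Level} (R : CommutativeRing c ℓ) where
  open CommutativeRing R hiding (zero)

  ι : ℕ → Carrier
  ι zero = 0#
  ι (suc n) = 1# + ι n

  sgn : ℕ → Carrier
  sgn zero = 1#
  sgn (suc n) = - sgn n

  sumTo : ℕ → (ℕ → Carrier) → Carrier
  sumTo zero f = 0#
  sumTo (suc n) f = sumTo n f + f n

  prodTo : ℕ → (ℕ → Carrier) → Carrier
  prodTo zero f = 1#
  prodTo (suc n) f = prodTo n f * f n

  -- Σ_{j=a}^{b} f j  (empty, i.e. 0, when b < a)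
  sumRange : ℕ → ℕ → (ℕ → Carrier) → Carrier
  sumRange a b f = sumTo (suc b ∸ a) (λ i → f (a ℕ.+ i))

  -- coefficients of the monomial x^n
  mono : ℕ → ℕ → Carrier
  mono n j with n ℕ.≟ j
  ... | yes _ = 1#
  ... | no _ = 0#

  shiftα : (ℕ → Carrier) → Carrier → ℕ → Carrier
  shiftα α m j = α j + ι j * m

  -- coefficient sequence of the polynomial (x;ᾱ|m)_n = Π_{j<n} (x - α_j - j m),
  -- computed by multiplying out the product one linear factor at a time
  fallCoeff : (ℕ → Carrier) → Carrier → ℕ → ℕ → Carrier
  fallCoeff α m zero j = mono zero j
  fallCoeff α m (suc n) zero = - (shiftα α m n * fallCoeff α m n zero)
  fallCoeff α m (suc n) (suc j) =
    fallCoeff α m n j - shiftα α m n * fallCoeff α m n (suc j)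

  whitney1 : (ℕ → Carrier) → Carrier → ℕ → ℕ → Carrier
  whitney1 = fallCoeff

  fallEval : (ℕ → Carrier) → Carrier → ℕ → Carrier → Carrier
  fallEval α m n x = prodTo n (λ j → x - shiftα α m j)

  riseEval : (ℕ → Carrier) → Carrier → ℕ → Carrier → Carrier
  riseEval α m n x = prodTo n (λ i → x + α i + ι i * m)

  -- W is the family of ᾱ-Whitney numbers of the second kind:
  -- W(n,k) = 0 for k > n, and x^n = Σ_{k=0}^n W(n,k) (x;ᾱ|m)_k as a polynomial
  -- identity (equality of all coefficients).
  IsWhitney2 : (ℕ → Carrier) → Carrier → (ℕ → ℕ → Carrier) → Set ℓ
  IsWhitney2 α m W =
    (∀ n k → n < k → W n k ≈ 0#) ×
    (∀ n j → mono n j ≈ sumTo (suc n) (λ k → W n k * whitney1 α m k j))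

  whitneyLah : (ℕ → Carrier) → Carrier → (ℕ → ℕ → Carrier) → ℕ → ℕ → Carrier
  whitneyLah α m W n k =
    sumRange k n (λ j → sgn (n ∸ j) * whitney1 α m n j * W j k)

-- Substituting -x into (x;ᾱ|m)_n gives (-1)^n times the rising product, so the rising
-- product is Σ_j (-1)^(n-j) w(n,j) x^j.  Expanding each x^j in the basis (x;ᾱ|m)_k by the
-- second-kind numbers and exchanging the two sums leaves exactly the Whitney-Lah
-- coefficients, once the triangularity W(j,k) = 0 for j < k lets the inner sum over j
-- start at k as in their definition.
module Submission where

open import Defs
open import Level using (Level)
open import Algebra.Bundles using (CommutativeRing)
open import Data.Nat using (ℕ; zero; suc; _<_; _≤_; _∸_)
import Data.Nat as ℕ
import Data.Nat.Properties as ℕ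
open import Data.Product using (proj₁; proj₂)
open import Data.Empty using (⊥-elim)
open import Relation.Nullary using (yes; no; ¬_)
import Relation.Binary.PropositionalEquality as ≡

module FiniteSums {c ℓ : Level} (R : CommutativeRing c ℓ) where
  open CommutativeRing R hiding (zero)
  open import Relation.Binary.Reasoning.Setoid setoid
  open import Algebra.Properties.CommutativeSemigroup +-commutativeSemigroup using (interchange)

  sumTo-cong : ∀ n {f g : ℕ → Carrier} → (∀ i → i < n → f i ≈ g i) → sumTo R n f ≈ sumTo R n g
  sumTo-cong zero    f≈g = refl
  sumTo-cong (suc n) f≈g = +-cong (sumTo-cong n (λ i i<n → f≈g i (ℕ.m<n⇒m<1+n i<n))) (f≈g n (ℕ.n<1+n n))

  sumTo-zero : ∀ n {f : ℕ → Carrier} → (∀ i → i < n → f i ≈ 0#) → sumTo R n f ≈ 0#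
  sumTo-zero n f≈0 = trans (sumTo-cong n f≈0) (sumTo-const-0 n)
    where
    sumTo-const-0 : ∀ n → sumTo R n (λ _ → 0#) ≈ 0#
    sumTo-const-0 zero    = refl
    sumTo-const-0 (suc n) = trans (+-congʳ (sumTo-const-0 n)) (+-identityˡ 0#)

  sumTo-distrib-+ : ∀ n (f g : ℕ → Carrier) →
    sumTo R n (λ i → f i + g i) ≈ sumTo R n f + sumTo R n g
  sumTo-distrib-+ zero    f g = sym (+-identityˡ 0#)
  sumTo-distrib-+ (suc n) f g = trans (+-congʳ (sumTo-distrib-+ n f g)) (interchange _ _ _ _)

  *-distribˡ-sumTo : ∀ n x (f : ℕ → Carrier) → x * sumTo R n f ≈ sumTo R n (λ i → x * f i)
  *-distribˡ-sumTo zero    x f = zeroʳ x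
  *-distribˡ-sumTo (suc n) x f = trans (distribˡ x _ _) (+-congʳ (*-distribˡ-sumTo n x f))

  *-distribʳ-sumTo : ∀ n x (f : ℕ → Carrier) → sumTo R n f * x ≈ sumTo R n (λ i → f i * x)
  *-distribʳ-sumTo zero    x f = zeroˡ x
  *-distribʳ-sumTo (suc n) x f = trans (distribʳ x _ _) (+-congʳ (*-distribʳ-sumTo n x f))

  sumTo-comm : ∀ n N (f : ℕ → ℕ → Carrier) →
    sumTo R n (λ j → sumTo R N (f j)) ≈ sumTo R N (λ k → sumTo R n (λ j → f j k))
  sumTo-comm zero    N f = sym (sumTo-zero N (λ _ _ → refl))
  sumTo-comm (suc n) N f = trans (+-congʳ (sumTo-comm n N f)) (sym (sumTo-distrib-+ N _ _))

  sumTo-*-sumTo-comm : ∀ n N (a : ℕ → Carrier) (b : ℕ → ℕ → Carrier) (f : ℕ → Carrier) →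
    sumTo R n (λ j → a j * sumTo R N (λ k → b j k * f k)) ≈
    sumTo R N (λ k → sumTo R n (λ j → a j * b j k) * f k)
  sumTo-*-sumTo-comm n N a b f = begin
    sumTo R n (λ j → a j * sumTo R N (λ k → b j k * f k))
      ≈⟨ sumTo-cong n (λ j _ → *-distribˡ-sumTo N (a j) _) ⟩
    sumTo R n (λ j → sumTo R N (λ k → a j * (b j k * f k)))
      ≈⟨ sumTo-comm n N _ ⟩
    sumTo R N (λ k → sumTo R n (λ j → a j * (b j k * f k)))
      ≈⟨ sumTo-cong N (λ k _ → sumTo-cong n (λ j _ → sym (*-assoc _ _ _))) ⟩
    sumTo R N (λ k → sumTo R n (λ j → a j * b j k * f k))
      ≈⟨ sumTo-cong N (λ k _ → sym (*-distribʳ-sumTo n (f k) _)) ⟩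
    sumTo R N (λ k → sumTo R n (λ j → a j * b j k) * f k) ∎

  sumTo-suc-head : ∀ n (f : ℕ → Carrier) → sumTo R (suc n) f ≈ f 0 + sumTo R n (λ i → f (suc i))
  sumTo-suc-head zero    f = +-comm 0# (f 0)
  sumTo-suc-head (suc n) f = trans (+-congʳ (sumTo-suc-head n f)) (+-assoc _ _ _)

  sumTo-+ : ∀ k d (f : ℕ → Carrier) → sumTo R (k ℕ.+ d) f ≈ sumTo R k f + sumTo R d (λ i → f (k ℕ.+ i))
  sumTo-+ k zero    f rewrite ℕ.+-identityʳ k = sym (+-identityʳ _)
  sumTo-+ k (suc d) f rewrite ℕ.+-suc k d = trans (+-congʳ (sumTo-+ k d f)) (+-assoc _ _ _)

  sumTo-split : ∀ {k n} (f : ℕ → Carrier) → k ≤ n →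
    sumTo R n f ≈ sumTo R k f + sumTo R (n ∸ k) (λ i → f (k ℕ.+ i))
  sumTo-split {k} {n} f k≤n = begin
    sumTo R n f              ≡⟨ ≡.cong (λ N → sumTo R N f) (ℕ.m+[n∸m]≡n k≤n) ⟨
    sumTo R (k ℕ.+ (n ∸ k)) f ≈⟨ sumTo-+ k (n ∸ k) f ⟩
    sumTo R k f + sumTo R (n ∸ k) (λ i → f (k ℕ.+ i)) ∎

  sumTo-extend : ∀ {k n} (f : ℕ → Carrier) → k ≤ n → (∀ i → k ≤ i → f i ≈ 0#) →
    sumTo R k f ≈ sumTo R n f
  sumTo-extend {k} {n} f k≤n tail≈0 = sym (begin
    sumTo R n f                                       ≈⟨ sumTo-split f k≤n ⟩
    sumTo R k f + sumTo R (n ∸ k) (λ i → f (k ℕ.+ i)) ≈⟨ +-congˡ (sumTo-zero (n ∸ k) (λ i _ → tail≈0 (k ℕ.+ i) (ℕ.m≤m+n k i))) ⟩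
    sumTo R k f + 0#                                  ≈⟨ +-identityʳ _ ⟩
    sumTo R k f                                       ∎)

  sumTo-sumRange : ∀ {k n} (f : ℕ → Carrier) → k ≤ suc n → (∀ j → j < k → f j ≈ 0#) →
    sumTo R (suc n) f ≈ sumRange R k n f
  sumTo-sumRange {k} {n} f k≤n head≈0 = begin
    sumTo R (suc n) f                   ≈⟨ sumTo-split f k≤n ⟩
    sumTo R k f + sumRange R k n f      ≈⟨ +-congʳ (sumTo-zero k head≈0) ⟩
    0# + sumRange R k n f               ≈⟨ +-identityˡ _ ⟩
    sumRange R k n f                    ∎

module Signs {c ℓ : Level} (R : CommutativeRing c ℓ) where
  open CommutativeRing R hiding (zero)
  open import Relation.Binary.Reasoning.Setoid setoid
  open import Algebra.Properties.Ring ring using (-‿distribˡ-*; -‿distribʳ-*; -‿involutive; -1*x≈-x)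
  open import Algebra.Properties.CommutativeSemiring.Exp commutativeSemiring using (_^_; ^-distrib-*; ^-congˡ)

  sgn-+ : ∀ a b → sgn R (a ℕ.+ b) ≈ sgn R a * sgn R b
  sgn-+ zero    b = sym (*-identityˡ _)
  sgn-+ (suc a) b = trans (-‿cong (sgn-+ a b)) (-‿distribˡ-* _ _)

  sgn≈-1^ : ∀ n → sgn R n ≈ (- 1#) ^ n
  sgn≈-1^ zero    = refl
  sgn≈-1^ (suc n) = trans (-‿cong (sgn≈-1^ n)) (sym (-1*x≈-x _))

  sgn-*-sgn : ∀ n → sgn R n * sgn R n ≈ 1#
  sgn-*-sgn zero    = *-identityˡ 1#
  sgn-*-sgn (suc n) = begin
    - sgn R n * - sgn R n       ≈⟨ -‿distribˡ-* _ _ ⟨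
    - (sgn R n * - sgn R n)     ≈⟨ -‿cong (-‿distribʳ-* _ _) ⟨
    - - (sgn R n * sgn R n)     ≈⟨ -‿involutive _ ⟩
    sgn R n * sgn R n           ≈⟨ sgn-*-sgn n ⟩
    1#                          ∎

  sgn-∸ : ∀ {n j} → j ≤ n → sgn R n * sgn R j ≈ sgn R (n ∸ j)
  sgn-∸ {n} {j} j≤n = begin
    sgn R n * sgn R j                     ≡⟨ ≡.cong (λ k → sgn R k * sgn R j) (ℕ.m∸n+n≡m j≤n) ⟨
    sgn R (n ∸ j ℕ.+ j) * sgn R j         ≈⟨ *-congʳ (sgn-+ (n ∸ j) j) ⟩
    sgn R (n ∸ j) * sgn R j * sgn R j     ≈⟨ *-assoc _ _ _ ⟩
    sgn R (n ∸ j) * (sgn R j * sgn R j)   ≈⟨ *-congˡ (sgn-*-sgn j) ⟩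
    sgn R (n ∸ j) * 1#                    ≈⟨ *-identityʳ _ ⟩
    sgn R (n ∸ j)                         ∎

  -x^n≈sgn*x^n : ∀ x n → (- x) ^ n ≈ sgn R n * x ^ n
  -x^n≈sgn*x^n x n = begin
    (- x) ^ n             ≈⟨ ^-congˡ n (-1*x≈-x x) ⟨
    (- 1# * x) ^ n        ≈⟨ ^-distrib-* (- 1#) x n ⟩
    (- 1#) ^ n * x ^ n    ≈⟨ *-congʳ (sgn≈-1^ n) ⟨
    sgn R n * x ^ n       ∎

  prodTo-cong : ∀ n {f g : ℕ → Carrier} → (∀ i → f i ≈ g i) → prodTo R n f ≈ prodTo R n g
  prodTo-cong zero    f≈g = refl
  prodTo-cong (suc n) f≈g = *-cong (prodTo-cong n f≈g) (f≈g n)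

  prodTo-neg : ∀ n (f : ℕ → Carrier) → prodTo R n (λ i → - f i) ≈ sgn R n * prodTo R n f
  prodTo-neg zero    f = sym (*-identityˡ 1#)
  prodTo-neg (suc n) f = begin
    prodTo R n (λ i → - f i) * - f n         ≈⟨ *-congʳ (prodTo-neg n f) ⟩
    sgn R n * prodTo R n f * - f n           ≈⟨ -‿distribʳ-* _ _ ⟨
    - (sgn R n * prodTo R n f * f n)         ≈⟨ -‿cong (*-assoc _ _ _) ⟩
    - (sgn R n * (prodTo R n f * f n))       ≈⟨ -‿distribˡ-* _ _ ⟩
    - sgn R n * (prodTo R n f * f n)         ∎

module Polynomials {c ℓ : Level} (R : CommutativeRing c ℓ) where
  open CommutativeRing R hiding (zero)
  open import Relation.Binary.Reasoning.Setoid setoid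
  open import Algebra.Properties.Ring ring using (-‿distribˡ-*; [y-z]x≈yx-zx; x[y-z]≈xy-xz)
  open import Algebra.Properties.AbelianGroup +-abelianGroup using (⁻¹-∙-comm)
  open import Algebra.Properties.CommutativeSemigroup +-commutativeSemigroup using (x∙yz≈y∙xz)
  open import Algebra.Properties.CommutativeSemiring.Exp commutativeSemiring using (_^_)
  open FiniteSums R

  polyEval : ℕ → (ℕ → Carrier) → Carrier → Carrier
  polyEval N a x = sumTo R N (λ j → a j * x ^ j)

  polyEval-extend : ∀ {k N} (a : ℕ → Carrier) x → k ≤ N → (∀ j → k ≤ j → a j ≈ 0#) →
    polyEval k a x ≈ polyEval N a x
  polyEval-extend a x k≤N a≈0 = sumTo-extend _ k≤N (λ j k≤j → trans (*-congʳ (a≈0 j k≤j)) (zeroˡ _))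

  mono-diag : ∀ n → mono R n n ≈ 1#
  mono-diag n with n ℕ.≟ n
  ... | yes _   = refl
  ... | no  n≢n = ⊥-elim (n≢n ≡.refl)

  mono-off : ∀ {n j} → ¬ (n ≡.≡ j) → mono R n j ≈ 0#
  mono-off {n} {j} n≢j with n ℕ.≟ j
  ... | yes n≡j = ⊥-elim (n≢j n≡j)
  ... | no  _   = refl

  polyEval-mono : ∀ n x → polyEval (suc n) (mono R n) x ≈ x ^ n
  polyEval-mono n x = begin
    polyEval n (mono R n) x + mono R n n * x ^ n
      ≈⟨ +-cong (sumTo-zero n (λ j j<n → trans (*-congʳ (mono-off (ℕ.>⇒≢ j<n))) (zeroˡ _)))
                (*-congʳ (mono-diag n)) ⟩
    0# + 1# * x ^ n ≈⟨ trans (+-identityˡ _) (*-identityˡ _) ⟩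
    x ^ n ∎

  -- Coefficients of the product (X - a) · Σ_j c_j X^j.
  mulLinear : Carrier → (ℕ → Carrier) → ℕ → Carrier
  mulLinear a c zero    = - (a * c zero)
  mulLinear a c (suc j) = c j - a * c (suc j)

  mulLinear-degree : ∀ {n} a (c : ℕ → Carrier) → (∀ j → n < j → c j ≈ 0#) →
    ∀ j → suc n < j → mulLinear a c j ≈ 0#
  mulLinear-degree a c c≈0 (suc j) (ℕ.s≤s n<j) = begin
    c j - a * c (suc j) ≈⟨ +-cong (c≈0 j n<j) (-‿cong (*-congˡ (c≈0 (suc j) (ℕ.m<n⇒m<1+n n<j)))) ⟩
    0# - a * 0#         ≈⟨ +-cong refl (-‿cong (zeroʳ a)) ⟩
    0# - 0#             ≈⟨ -‿inverseʳ 0# ⟩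
    0#                  ∎

  polyEval-mulLinear : ∀ N a (c : ℕ → Carrier) x → c N ≈ 0# →
    polyEval (suc N) (mulLinear a c) x ≈ polyEval N c x * (x - a)
  polyEval-mulLinear N a c x cN≈0 = begin
    polyEval (suc N) (mulLinear a c) x
      ≈⟨ sumTo-suc-head N _ ⟩
    - (a * c 0) * 1# + sumTo R N (λ i → (c i - a * c (suc i)) * (x * x ^ i))
      ≈⟨ +-congˡ (sumTo-cong N (λ i _ → split-term (c i) (c (suc i)) (x ^ i))) ⟩
    - (a * c 0) * 1# + sumTo R N (λ i → c i * x ^ i * x + - (a * (c (suc i) * x ^ suc i)))
      ≈⟨ +-congˡ (sumTo-distrib-+ N _ _) ⟩
    - (a * c 0) * 1# + (sumTo R N (λ i → c i * x ^ i * x) + sumTo R N (λ i → - (a * (c (suc i) * x ^ suc i))))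
      ≈⟨ +-congˡ (+-cong (sym (*-distribʳ-sumTo N x _)) (neg-sum N (λ i → c (suc i) * x ^ suc i))) ⟩
    - (a * c 0) * 1# + (P * x - a * sumTo R N (λ i → c (suc i) * x ^ suc i))
      ≈⟨ +-congʳ (trans (sym (-‿distribˡ-* _ _)) (-‿cong (*-assoc _ _ _))) ⟩
    - (a * (c 0 * 1#)) + (P * x - a * sumTo R N (λ i → c (suc i) * x ^ suc i))
      ≈⟨ x∙yz≈y∙xz _ _ _ ⟩
    P * x + (- (a * (c 0 * 1#)) - a * sumTo R N (λ i → c (suc i) * x ^ suc i))
      ≈⟨ +-congˡ (trans (⁻¹-∙-comm _ _) (-‿cong (sym (distribˡ a _ _)))) ⟩
    P * x - a * (c 0 * 1# + sumTo R N (λ i → c (suc i) * x ^ suc i))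
      ≈⟨ +-congˡ (-‿cong (*-congˡ (sym (sumTo-suc-head N _)))) ⟩
    P * x - a * polyEval (suc N) c x
      ≈⟨ +-congˡ (-‿cong (*-congˡ top-vanishes)) ⟩
    P * x - a * P
      ≈⟨ +-congˡ (-‿cong (*-comm a P)) ⟩
    P * x - P * a
      ≈⟨ x[y-z]≈xy-xz P x a ⟨
    P * (x - a) ∎
    where
    P = polyEval N c x

    split-term : ∀ u v y → (u - a * v) * (x * y) ≈ u * y * x + - (a * (v * (x * y)))
    split-term u v y = begin
      (u - a * v) * (x * y)               ≈⟨ [y-z]x≈yx-zx (x * y) u (a * v) ⟩
      u * (x * y) - a * v * (x * y)       ≈⟨ +-cong (*-congˡ (*-comm x y)) (-‿cong (*-assoc a v _)) ⟩
      u * (y * x) - a * (v * (x * y))     ≈⟨ +-congʳ (sym (*-assoc u y x)) ⟩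
      u * y * x + - (a * (v * (x * y)))   ∎

    neg-sum : ∀ n (f : ℕ → Carrier) → sumTo R n (λ i → - (a * f i)) ≈ - (a * sumTo R n f)
    neg-sum n f = begin
      sumTo R n (λ i → - (a * f i)) ≈⟨ sumTo-cong n (λ i _ → -‿distribˡ-* a (f i)) ⟩
      sumTo R n (λ i → - a * f i)   ≈⟨ *-distribˡ-sumTo n (- a) f ⟨
      - a * sumTo R n f             ≈⟨ -‿distribˡ-* a _ ⟨
      - (a * sumTo R n f)           ∎

    top-vanishes : polyEval (suc N) c x ≈ P
    top-vanishes = trans (+-congˡ (trans (*-congʳ cN≈0) (zeroˡ _))) (+-identityʳ P)

module WhitneyNumbers {c ℓ : Level} (R : CommutativeRing c ℓ)
  (m : CommutativeRing.Carrier R) (α : ℕ → CommutativeRing.Carrier R) where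
  open CommutativeRing R hiding (zero)
  open import Relation.Binary.Reasoning.Setoid setoid
  open import Algebra.Properties.Ring ring using (-‿involutive)
  open import Algebra.Properties.AbelianGroup +-abelianGroup using (⁻¹-∙-comm)
  open import Algebra.Properties.CommutativeSemigroup *-commutativeSemigroup using (x∙yz≈y∙xz)
  open import Algebra.Properties.CommutativeSemiring.Exp commutativeSemiring using (_^_)
  open FiniteSums R
  open Signs R
  open Polynomials R

  fallCoeff-suc : ∀ n j → fallCoeff R α m (suc n) j ≡.≡ mulLinear (shiftα R α m n) (fallCoeff R α m n) j
  fallCoeff-suc n zero    = ≡.refl
  fallCoeff-suc n (suc j) = ≡.refl

  fallCoeff-degree : ∀ n j → n < j → fallCoeff R α m n j ≈ 0#
  fallCoeff-degree zero    j 0<j = mono-off (ℕ.<⇒≢ 0<j)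
  fallCoeff-degree (suc n) j n<j = begin
    fallCoeff R α m (suc n) j                               ≡⟨ fallCoeff-suc n j ⟩
    mulLinear (shiftα R α m n) (fallCoeff R α m n) j        ≈⟨ mulLinear-degree _ _ (fallCoeff-degree n) j n<j ⟩
    0#                                                      ∎

  fallEval-polyEval : ∀ n x → fallEval R α m n x ≈ polyEval (suc n) (fallCoeff R α m n) x
  fallEval-polyEval zero    x = sym (polyEval-mono 0 x)
  fallEval-polyEval (suc n) x = begin
    fallEval R α m n x * (x - s)
      ≈⟨ *-congʳ (fallEval-polyEval n x) ⟩
    polyEval (suc n) (fallCoeff R α m n) x * (x - s)
      ≈⟨ polyEval-mulLinear (suc n) s _ x (fallCoeff-degree n (suc n) (ℕ.n<1+n n)) ⟨
    polyEval (suc (suc n)) (mulLinear s (fallCoeff R α m n)) x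
      ≈⟨ sumTo-cong (suc (suc n)) (λ j _ → *-congʳ (reflexive (≡.sym (fallCoeff-suc n j)))) ⟩
    polyEval (suc (suc n)) (fallCoeff R α m (suc n)) x ∎
    where
    s = shiftα R α m n

  riseEval-reflect : ∀ n x → riseEval R α m n x ≈ sgn R n * fallEval R α m n (- x)
  riseEval-reflect n x = trans (prodTo-cong n factor) (prodTo-neg n _)
    where
    factor : ∀ i → x + α i + ι R i * m ≈ - (- x - shiftα R α m i)
    factor i = begin
      x + α i + ι R i * m         ≈⟨ +-assoc _ _ _ ⟩
      x + shiftα R α m i          ≈⟨ -‿involutive _ ⟨
      - - (x + shiftα R α m i)    ≈⟨ -‿cong (⁻¹-∙-comm _ _) ⟨
      - (- x - shiftα R α m i)    ∎

  riseEval-polyEval : ∀ n x →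
    riseEval R α m n x ≈ polyEval (suc n) (λ j → sgn R (n ∸ j) * fallCoeff R α m n j) x
  riseEval-polyEval n x = begin
    riseEval R α m n x
      ≈⟨ riseEval-reflect n x ⟩
    sgn R n * fallEval R α m n (- x)
      ≈⟨ *-congˡ (fallEval-polyEval n (- x)) ⟩
    sgn R n * polyEval (suc n) (fallCoeff R α m n) (- x)
      ≈⟨ *-distribˡ-sumTo (suc n) _ _ ⟩
    sumTo R (suc n) (λ j → sgn R n * (fallCoeff R α m n j * (- x) ^ j))
      ≈⟨ sumTo-cong (suc n) (λ j j≤n → term j (ℕ.m<1+n⇒m≤n j≤n)) ⟩
    polyEval (suc n) (λ j → sgn R (n ∸ j) * fallCoeff R α m n j) x ∎
    where
    term : ∀ j → j ≤ n →
      sgn R n * (fallCoeff R α m n j * (- x) ^ j) ≈ sgn R (n ∸ j) * fallCoeff R α m n j * x ^ j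
    term j j≤n = begin
      sgn R n * (fallCoeff R α m n j * (- x) ^ j)           ≈⟨ *-congˡ (*-congˡ (-x^n≈sgn*x^n x j)) ⟩
      sgn R n * (fallCoeff R α m n j * (sgn R j * x ^ j))   ≈⟨ *-congˡ (x∙yz≈y∙xz _ _ _) ⟩
      sgn R n * (sgn R j * (fallCoeff R α m n j * x ^ j))   ≈⟨ *-assoc _ _ _ ⟨
      sgn R n * sgn R j * (fallCoeff R α m n j * x ^ j)     ≈⟨ *-congʳ (sgn-∸ j≤n) ⟩
      sgn R (n ∸ j) * (fallCoeff R α m n j * x ^ j)         ≈⟨ *-assoc _ _ _ ⟨
      sgn R (n ∸ j) * fallCoeff R α m n j * x ^ j           ∎

  module _ (W : ℕ → ℕ → Carrier) where

    ^-as-fallEval : IsWhitney2 R α m W → ∀ {j n} x → j ≤ n →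
      x ^ j ≈ sumTo R (suc n) (λ k → W j k * fallEval R α m k x)
    ^-as-fallEval isW {j} {n} x j≤n = begin
      x ^ j
        ≈⟨ polyEval-mono j x ⟨
      polyEval (suc j) (mono R j) x
        ≈⟨ sumTo-cong (suc j) (λ i _ → *-congʳ (proj₂ isW j i)) ⟩
      sumTo R (suc j) (λ i → sumTo R (suc j) (λ k → W j k * fallCoeff R α m k i) * x ^ i)
        ≈⟨ sumTo-*-sumTo-comm (suc j) (suc j) _ _ _ ⟨
      sumTo R (suc j) (λ k → W j k * polyEval (suc j) (fallCoeff R α m k) x)
        ≈⟨ sumTo-cong (suc j) (λ k k<sj → *-congˡ (sym (fallEval-polyEval-≤ k<sj))) ⟩
      sumTo R (suc j) (λ k → W j k * fallEval R α m k x)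
        ≈⟨ sumTo-extend _ (ℕ.s≤s j≤n) (λ k j<k → trans (*-congʳ (proj₁ isW j k j<k)) (zeroˡ _)) ⟩
      sumTo R (suc n) (λ k → W j k * fallEval R α m k x) ∎
      where
      fallEval-polyEval-≤ : ∀ {k} → k < suc j → fallEval R α m k x ≈ polyEval (suc j) (fallCoeff R α m k) x
      fallEval-polyEval-≤ {k} k<sj =
        trans (fallEval-polyEval k x) (polyEval-extend _ x k<sj (fallCoeff-degree k))

    whitneyLah-as-sumTo : (∀ j k → j < k → W j k ≈ 0#) → ∀ {n k} → k ≤ n →
      whitneyLah R α m W n k ≈ sumTo R (suc n) (λ j → sgn R (n ∸ j) * fallCoeff R α m n j * W j k)
    whitneyLah-as-sumTo W≈0 {k = k} k≤n =
      sym (sumTo-sumRange _ (ℕ.m≤n⇒m≤1+n k≤n) (λ j j<k → trans (*-congˡ (W≈0 j k j<k)) (zeroʳ _)))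

mainTheorem9 : ∀ {c ℓ : Level} (R : CommutativeRing c ℓ)
    (m : CommutativeRing.Carrier R) (α : ℕ → CommutativeRing.Carrier R)
    (W : ℕ → ℕ → CommutativeRing.Carrier R) → IsWhitney2 R α m W →
    ∀ (n : ℕ) (x : CommutativeRing.Carrier R) →
    CommutativeRing._≈_ R (riseEval R α m n x)
      (sumTo R (suc n) (λ k → CommutativeRing._*_ R (whitneyLah R α m W n k) (fallEval R α m k x)))
mainTheorem9 R m α W isW n x = begin
  riseEval R α m n x
    ≈⟨ riseEval-polyEval n x ⟩
  sumTo R (suc n) (λ j → g j * x ^ j)
    ≈⟨ sumTo-cong (suc n) (λ j j<1+n → *-congˡ (^-as-fallEval W isW x (ℕ.m<1+n⇒m≤n j<1+n))) ⟩
  sumTo R (suc n) (λ j → g j * sumTo R (suc n) (λ k → W j k * fallEval R α m k x))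
    ≈⟨ sumTo-*-sumTo-comm (suc n) (suc n) g W _ ⟩
  sumTo R (suc n) (λ k → sumTo R (suc n) (λ j → g j * W j k) * fallEval R α m k x)
    ≈⟨ sumTo-cong (suc n) (λ k k<1+n →
         *-congʳ (sym (whitneyLah-as-sumTo W (proj₁ isW) (ℕ.m<1+n⇒m≤n k<1+n)))) ⟩
  sumTo R (suc n) (λ k → whitneyLah R α m W n k * fallEval R α m k x) ∎
  where
  open CommutativeRing R
  open import Relation.Binary.Reasoning.Setoid setoid
  open import Algebra.Properties.CommutativeSemiring.Exp commutativeSemiring using (_^_)
  open FiniteSums R
  open WhitneyNumbers R m α

  g : ℕ → Carrier
  g j = sgn R (n ∸ j) * fallCoeff R α m n j
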